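{- Let $k\ge1$ and $b\in\mathbb{N}$, let $\phi_1,\dots,\phi_k:[k]^b\to[k]^b$ be bijections, and let $\rho:[k]^b\to[k]$ be any function. Then there is a bijection $\phi:[k]^{b+1}\to[k]^{b+1}$ such that (i) for every $x\in[k]$ and every $w\in[k]^b$ there exists $y\in[k]$ with $\phi(xw)=y\,\phi_x(w)$; and (ii) for every $w\in[k]^b$, $\phi(1w)=\rho(w)\,\phi_1(w)$.
   Context: $[k]=\{1,\dots,k\}$. Elements of $[k]^b$ are words of length $b$ over the alphabet $[k]$; for a letter $x\in[k]$ and a word $w\in[k]^b$, $xw$ denotes the word of length $b+1$ obtained by concatenation. (In the paper the domains are formally distinct copies of $[k]^b$ and $[k]^{b+1}$, which does not affect the statement.) -}

module Defs where

open import Data.Nat using (ℕ)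
open import Data.Fin using (Fin)
open import Data.Vec using (Vec)

-- [k] = Fin k, letters 1..k correspond to Fin.zero .. Fin.fromℕ (k-1);
-- the letter 1 is Fin.zero.
-- Words of length b over [k]:
Word : ℕ → ℕ → Set
Word k b = Vec (Fin k) b

-- Send x w to σ_u(x) u, where u = φ_x(w) and σ_u is the transposition of 1 and ρ(φ₁⁻¹ u).
-- Rewriting the tail fibrewise by the bijections φ_x and then the head fibrewise by the
-- permutations σ_u gives a bijection of [k]^{b+1}; on 1 w the head becomes σ_u(1) = ρ(w).
module Submission where

open import Defs
open import Level using (Level)
open import Data.Nat using (ℕ; suc)
open import Data.Fin using (Fin; zero)
open import Data.Fin.Properties using (_≟_)
open import Data.Fin.Permutation using (Permutation′; transpose; _⟨$⟩ʳ_)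
open import Data.Product using (Σ; ∃; _×_; _,_; uncurry)
open import Data.Product.Algebra using (×-comm)
open import Data.Product.Function.Dependent.Propositional using (Σ-↔)
open import Data.Vec using (Vec; _∷_; uncons)
open import Function.Bundles using (Bijection; _⤖_; _↔_; Inverse; mk↔ₛ′)
open import Function.Properties.Bijection using (⤖⇒↔)
open import Function.Properties.Inverse using (↔-refl; ↔-sym; ↔-trans; ↔⇒⤖)
open import Relation.Binary.PropositionalEquality using (_≡_; refl; cong; module ≡-Reasoning)
open import Relation.Nullary.Decidable using (dec-true)

transpose-appliedˡ : ∀ {n} (i j : Fin n) → transpose i j ⟨$⟩ʳ i ≡ j
transpose-appliedˡ i j rewrite dec-true (i ≟ i) refl = refl

private variable
  a b c : Level
  A : Set a
  B : Set b
  C : Set c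

infixr 9 _⨾_
_⨾_ : A ↔ B → B ↔ C → A ↔ C
_⨾_ = ↔-trans

×-fibrewiseʳ : (A → B ↔ C) → (A × B) ↔ (A × C)
×-fibrewiseʳ f = Σ-↔ ↔-refl (λ {x} → f x)

×-fibrewiseˡ : (C → A ↔ B) → (A × C) ↔ (B × C)
×-fibrewiseˡ σ = ×-comm _ _ ⨾ ×-fibrewiseʳ σ ⨾ ×-comm _ _

module _ {A : Set a} {n : ℕ} where

  ∷-↔ : (A × Vec A n) ↔ Vec A (suc n)
  ∷-↔ = mk↔ₛ′ (uncurry _∷_) uncons (λ { (x ∷ w) → refl }) (λ _ → refl)

  ∷-fibrewise : (A → Vec A n ↔ Vec A n) → (Vec A n → A ↔ A) → Vec A (suc n) ↔ Vec A (suc n)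
  ∷-fibrewise f σ = ↔-sym ∷-↔ ⨾ ×-fibrewiseʳ f ⨾ ×-fibrewiseˡ σ ⨾ ∷-↔

  ∷-fibrewise-∷ : ∀ f σ x w → let u = Inverse.to (f x) w in
                  Inverse.to (∷-fibrewise f σ) (x ∷ w) ≡ Inverse.to (σ u) x ∷ u
  ∷-fibrewise-∷ f σ x w = refl

lemma10 : (m b : ℕ) →
          (φs : Fin (suc m) → (Word (suc m) b ⤖ Word (suc m) b)) →
          (ρ : Word (suc m) b → Fin (suc m)) →
          Σ (Word (suc m) (suc b) ⤖ Word (suc m) (suc b)) λ φ →
            ((x : Fin (suc m)) (w : Word (suc m) b) →
               ∃ λ (y : Fin (suc m)) →
                 Bijection.to φ (x ∷ w) ≡ y ∷ Bijection.to (φs x) w)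
            × ((w : Word (suc m) b) →
                 Bijection.to φ (zero ∷ w) ≡ ρ w ∷ Bijection.to (φs zero) w)
lemma10 m b φs ρ = ↔⇒⤖ φ , (λ x w → _ , ∷-fibrewise-∷ tails heads x w) , head-of-zero
  where
  tails : Fin (suc m) → Word (suc m) b ↔ Word (suc m) b
  tails x = ⤖⇒↔ (φs x)

  heads : Word (suc m) b → Permutation′ (suc m)
  heads u = transpose zero (ρ (Inverse.from (tails zero) u))

  φ : Word (suc m) (suc b) ↔ Word (suc m) (suc b)
  φ = ∷-fibrewise tails heads

  head-of-zero : ∀ w → Inverse.to φ (zero ∷ w) ≡ ρ w ∷ Bijection.to (φs zero) w
  head-of-zero w = begin
    Inverse.to φ (zero ∷ w)                        ≡⟨ ∷-fibrewise-∷ tails heads zero w ⟩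
    (heads u ⟨$⟩ʳ zero) ∷ u                        ≡⟨ cong (λ v → (transpose zero (ρ v) ⟨$⟩ʳ zero) ∷ u)
                                                           (Inverse.strictlyInverseʳ (tails zero) w) ⟩
    (transpose zero (ρ w) ⟨$⟩ʳ zero) ∷ u           ≡⟨ cong (_∷ u) (transpose-appliedˡ zero (ρ w)) ⟩
    ρ w ∷ u                                        ∎
    where
    open ≡-Reasoning
    u : Word (suc m) b
    u = Bijection.to (φs zero) w
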